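{- For $i\in\{1,2\}$, let $G_i$ be a graph with maximum degree $\Delta_i$ and degeneracy $d_i$ that contains $K_{s_i,t_i}$ as a subgraph, where $s_i,t_i$ are positive integers with $s_i\leq t_i$. Let $$f(s_1,t_1,s_2,t_2):=\max\{s_1+s_2+s_1s_2,\ \min\{t_1+t_2,s_1(t_2+1),s_2(t_1+1)\},\ \min\{s_1t_2,s_2t_1\}\}.$$ Then $$\max\{d_1+d_2+d_1d_2,\ f(s_1,t_1,s_2,t_2),\ \min\{\Delta_1,\Delta_2\}+1\}\leq\operatorname{degen}(G_1\boxtimes G_2)\leq d_1+d_2+\min\{d_1\Delta_2,\ d_2\Delta_1\}.$$
   Context: All graphs are finite and simple. The degeneracy $\operatorname{degen}(G)$ is the minimum integer $d$ such that every subgraph of $G$ has minimum degree at most $d$. The strong product $G_1\boxtimes G_2$ has vertex set $V(G_1)\times V(G_2)$, with distinct $(a,v),(b,u)$ adjacent iff ($a=b$ or $ab\in E(G_1)$) and ($u=v$ or $uv\in E(G_2)$). -}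

module Defs where

open import Data.Nat using (ℕ; _≤_; _+_; _*_; _⊔_; _⊓_)
open import Data.Bool using (Bool; true; false; not; _∧_; _∨_)
open import Data.Fin using (Fin; remQuot; _≟_)
open import Data.Fin.Subset using (∣_∣)
open import Data.Vec using (tabulate)
open import Data.Product using (_×_; Σ; ∃; _,_; proj₁; proj₂)
open import Relation.Nullary using (¬_; does; yes; no)
open import Relation.Binary.PropositionalEquality using (_≡_; _≢_; refl; sym; cong₂)
open import Data.Empty using (⊥-elim)

record Graph : Set where
  field
    n      : ℕ
    adj    : Fin n → Fin n → Bool
    adj-sym : ∀ u v → adj u v ≡ adj v u
    adj-irr : ∀ v → adj v v ≡ false
open Graph public

deg : (G : Graph) → Fin (n G) → ℕ
deg G v = ∣ tabulate (adj G v) ∣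

-- Δ is the maximum degree of G (least upper bound of the degrees;
-- equals 0 for the empty graph).
IsMaxDegree : Graph → ℕ → Set
IsMaxDegree G Δ = (∀ v → deg G v ≤ Δ) × (∀ Δ' → (∀ v → deg G v ≤ Δ') → Δ ≤ Δ')

record Subgraph (G : Graph) : Set where
  field
    inV  : Fin (n G) → Bool
    inE  : Fin (n G) → Fin (n G) → Bool
    inE-adj : ∀ u v → inE u v ≡ true → adj G u v ≡ true
    inE-V   : ∀ u v → inE u v ≡ true → (inV u ≡ true) × (inV v ≡ true)
    inE-sym : ∀ u v → inE u v ≡ inE v u
open Subgraph public

degH : {G : Graph} → Subgraph G → Fin (n G) → ℕ
degH H v = ∣ tabulate (inE H v) ∣

Nonempty : {G : Graph} → Subgraph G → Set
Nonempty H = ∃ λ v → inV H v ≡ true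

MinDegAtMost : {G : Graph} → Subgraph G → ℕ → Set
MinDegAtMost H d = ∃ λ v → (inV H v ≡ true) × (degH H v ≤ d)

EveryMinDegAtMost : Graph → ℕ → Set
EveryMinDegAtMost G d = (H : Subgraph G) → Nonempty H → MinDegAtMost H d

IsDegeneracy : Graph → ℕ → Set
IsDegeneracy G d = EveryMinDegAtMost G d × (∀ d' → EveryMinDegAtMost G d' → d ≤ d')

ContainsKst : Graph → ℕ → ℕ → Set
ContainsKst G s t =
  Σ (Fin s → Fin (n G)) λ a → Σ (Fin t → Fin (n G)) λ b →
    (∀ i i' → a i ≡ a i' → i ≡ i') ×
    (∀ j j' → b j ≡ b j' → j ≡ j') ×
    (∀ i j → a i ≢ b j) ×
    (∀ i j → adj G (a i) (b j) ≡ true)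

eqb : {m : ℕ} → Fin m → Fin m → Bool
eqb x y = does (x ≟ y)

eqb-sym : {m : ℕ} (x y : Fin m) → eqb x y ≡ eqb y x
eqb-sym x y with x ≟ y | y ≟ x
... | yes _ | yes _ = refl
... | no _  | no _  = refl
... | yes p | no q  = ⊥-elim (q (sym p))
... | no p  | yes q = ⊥-elim (p (sym q))

eqb-refl : {m : ℕ} (x : Fin m) → eqb x x ≡ true
eqb-refl x with x ≟ x
... | yes _ = refl
... | no q  = ⊥-elim (q refl)

-- Strong product. The vertex (a , u) ∈ V(G₁) × V(G₂) is encoded as
-- combine a u : Fin (n G₁ * n G₂), decoded by remQuot.
pairAdj : (G₁ G₂ : Graph) → Fin (n G₁) × Fin (n G₂) → Fin (n G₁) × Fin (n G₂) → Bool
pairAdj G₁ G₂ (a , u) (b , v) =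
  (eqb a b ∨ adj G₁ a b) ∧ (eqb u v ∨ adj G₂ u v)

pairAdj-sym : (G₁ G₂ : Graph) → ∀ p q → pairAdj G₁ G₂ p q ≡ pairAdj G₁ G₂ q p
pairAdj-sym G₁ G₂ (a , u) (b , v)
  rewrite eqb-sym a b | eqb-sym u v | adj-sym G₁ a b | adj-sym G₂ u v = refl

⊠adj : (G₁ G₂ : Graph) → Fin (n G₁ * n G₂) → Fin (n G₁ * n G₂) → Bool
⊠adj G₁ G₂ x y =
  not (eqb x y) ∧ pairAdj G₁ G₂ (remQuot (n G₂) x) (remQuot (n G₂) y)

⊠adj-sym : (G₁ G₂ : Graph) → ∀ x y → ⊠adj G₁ G₂ x y ≡ ⊠adj G₁ G₂ y x
⊠adj-sym G₁ G₂ x y =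
  cong₂ (λ b c → not b ∧ c) (eqb-sym x y)
        (pairAdj-sym G₁ G₂ (remQuot (n G₂) x) (remQuot (n G₂) y))

⊠adj-irr : (G₁ G₂ : Graph) → ∀ x → ⊠adj G₁ G₂ x x ≡ false
⊠adj-irr G₁ G₂ x rewrite eqb-refl x = refl

_⊠_ : Graph → Graph → Graph
G₁ ⊠ G₂ = record
  { n = n G₁ * n G₂
  ; adj = ⊠adj G₁ G₂
  ; adj-sym = ⊠adj-sym G₁ G₂
  ; adj-irr = ⊠adj-irr G₁ G₂
  }

f : ℕ → ℕ → ℕ → ℕ → ℕ
f s₁ t₁ s₂ t₂ =
  (s₁ + s₂ + s₁ * s₂)
  ⊔ ((t₁ + t₂) ⊓ (s₁ * (t₂ + 1)) ⊓ (s₂ * (t₁ + 1)))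
  ⊔ ((s₁ * t₂) ⊓ (s₂ * t₁))

{-# OPTIONS --safe #-}
module Submission where

-- The degeneracy of a graph is at least k as soon as some
-- nonempty vertex set induces minimum degree at least k (a k-core), so each
-- lower bound is witnessed by a core of G₁ ⊠ G₂: the product of a d₁-core and
-- a d₂-core, whose closed neighbourhoods multiply to (d₁ + 1)(d₂ + 1) vertices;
-- unions of products of the two sides of the bicliques; and the cross
-- {v₁} × N[v₂] ∪ N[v₁] × {v₂} at vertices of maximum degree.  The neighbours of
-- a vertex (a , u) of such a core are found in one or two rectangles S₁ × S₂
-- with S₁ ⊆ N[a] and S₂ ⊆ N[u] avoiding (a , u), and counted as |S₁| |S₂|.
--
-- In a nonempty subgraph H of G₁ ⊠ G₂ choose a vertex a of degree
-- at most d₁ in the projection of H to G₁, then u of degree at most d₂ in the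
-- fibre of H over a.  A neighbour of (a , u) in H lies either in that fibre (at
-- most d₂ of them) or over one of the at most d₁ neighbours of a in the
-- projection, within N[u] (at most d₁ (Δ₂ + 1) of them).  Exchanging the roles
-- of the factors gives d₁ + d₂ + d₂ Δ₁.

open import Defs
open import Level using (Level; 0ℓ)
open import Data.Nat using (ℕ; zero; suc; _≤_; _<_; _≤?_; _+_; _*_; _⊔_; _⊓_; z≤n; s≤s)
open import Data.Nat.Properties
  using ( module ≤-Reasoning; ≤-antisym; ≤-trans; ≤-reflexive; ≤-pred; ≰⇒>; 1+n≰n; m≤n⇒m≤1+n; n≤1+n
        ; +-suc; +-assoc; +-comm; +-identityʳ; *-comm; *-identityˡ; *-identityʳ; *-distribʳ-+
        ; +-mono-≤; +-monoˡ-≤; +-monoʳ-≤; *-mono-≤; m⊓n≤m; m⊓n≤n; ⊔-lub; ⊓-glb; ⊓-mono-≤; +-distribˡ-⊓ )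
import Data.Nat.Properties as ℕ
open import Data.Nat.Solver using (module +-*-Solver)
open import Data.Bool using (Bool; true; false; T; not; _∧_; _∨_; if_then_else_)
import Data.Bool.Properties as Bool
open import Data.Fin using (Fin; zero; suc; _≟_; remQuot; combine; _↑ˡ_; _↑ʳ_)
open import Data.Fin.Properties using (suc-injective; 0≢1+n; any?; splitAt-↑ʳ; remQuot-combine; combine-remQuot)
open import Data.Fin.Subset using (∣_∣)
open import Data.Vec using (tabulate)
open import Data.List using (allFin)
open import Data.List.Extrema.Nat using (argmax; f[xs]≤f[argmax])
import Data.List.Relation.Unary.All as All
open import Data.List.Membership.Propositional.Properties using (∈-allFin)
open import Data.Product using (_×_; _,_; proj₁; proj₂; ∃; uncurry; swap; map; map₁)
open import Data.Sum using (_⊎_; inj₁; inj₂; [_,_])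
import Data.Sum as Sum
open import Data.Unit using (tt)
open import Data.Empty using (⊥-elim)
open import Function using (_∘_; id; Injective; Equivalence)
open import Relation.Nullary using (Dec; does; yes; no; contradiction; _×-dec_)
open import Relation.Nullary.Decidable using (T?; dec-true; dec-false)
open import Relation.Unary
  using (Pred; Decidable; _∈_; _∉_; _⊆_; _∪_; _∩_; ∁; ｛_｝; Satisfiable; _⊥_; _⊢_; _⟨×⟩_)
open import Relation.Unary.Properties using (_∪?_; _∩?_; ∁?; U?; _×?_)
open import Relation.Binary.PropositionalEquality
  using (_≡_; _≢_; refl; sym; trans; cong; cong₂; subst; module ≡-Reasoning)

private
  variable
    m k d : ℕ
    ℓ ℓ₁ ℓ₂ : Level
    G : Graph

count : {P : Pred (Fin m) ℓ} → Decidable P → ℕ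
count {m = zero}  P? = 0
count {m = suc m} P? = (if does (P? zero) then 1 else 0) + count (P? ∘ suc)

count-mono : {P : Pred (Fin m) ℓ₁} {Q : Pred (Fin m) ℓ₂} →
             (P? : Decidable P) (Q? : Decidable Q) → P ⊆ Q → count P? ≤ count Q?
count-mono {m = zero}  P? Q? P⊆Q = z≤n
count-mono {m = suc m} P? Q? P⊆Q with P? zero | Q? zero
... | yes _ | yes _  = s≤s (count-mono (P? ∘ suc) (Q? ∘ suc) P⊆Q)
... | yes p | no ¬q  = contradiction (P⊆Q p) ¬q
... | no _  | yes _  = m≤n⇒m≤1+n (count-mono (P? ∘ suc) (Q? ∘ suc) P⊆Q)
... | no _  | no _   = count-mono (P? ∘ suc) (Q? ∘ suc) P⊆Q

count-cong : {P : Pred (Fin m) ℓ₁} {Q : Pred (Fin m) ℓ₂} →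
             (P? : Decidable P) (Q? : Decidable Q) → P ⊆ Q → Q ⊆ P → count P? ≡ count Q?
count-cong P? Q? P⊆Q Q⊆P = ≤-antisym (count-mono P? Q? P⊆Q) (count-mono Q? P? Q⊆P)

count-empty : {P : Pred (Fin m) ℓ} (P? : Decidable P) → (∀ x → x ∉ P) → count P? ≡ 0
count-empty {m = zero}  P? ∉P = refl
count-empty {m = suc m} P? ∉P with P? zero
... | yes p = contradiction p (∉P zero)
... | no _  = count-empty (P? ∘ suc) (∉P ∘ suc)

count-singleton : (x : Fin m) → count (x ≟_) ≡ 1
count-singleton {m = suc m} zero = cong suc (count-empty {m = m} ((zero ≟_) ∘ suc) λ _ ())
count-singleton {m = suc m} (suc x) = trans
  (count-cong ((suc x ≟_) ∘ suc) (x ≟_) suc-injective (cong suc))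
  (count-singleton x)

count-∩∁-suc : {P : Pred (Fin (suc m)) ℓ} (P? : Decidable P) (x : Fin m) →
               count ((P? ∘ suc) ∩? ∁? (x ≟_)) ≡ count ((P? ∩? ∁? (suc x ≟_)) ∘ suc)
count-∩∁-suc P? x = count-cong ((P? ∘ suc) ∩? ∁? (x ≟_)) ((P? ∩? ∁? (suc x ≟_)) ∘ suc)
  (λ (p , x≢) → p , x≢ ∘ suc-injective) (λ (p , x≢) → p , x≢ ∘ cong suc)

count-remove : {P : Pred (Fin m) ℓ} (P? : Decidable P) {x : Fin m} → x ∈ P →
               count P? ≡ suc (count (P? ∩? ∁? (x ≟_)))
count-remove P? {zero} p with P? zero
... | no ¬p = contradiction p ¬p
... | yes _ = cong suc (count-cong (P? ∘ suc) ((P? ∩? ∁? (zero ≟_)) ∘ suc) (_, λ ()) proj₁)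
count-remove {m = suc m} P? {suc x} p with P? zero
... | yes _ = cong suc (trans (count-remove (P? ∘ suc) p) (cong suc (count-∩∁-suc P? x)))
... | no _  = trans (count-remove (P? ∘ suc) p) (cong suc (count-∩∁-suc P? x))

count-∪-≤ : {P : Pred (Fin m) ℓ₁} {Q : Pred (Fin m) ℓ₂} (P? : Decidable P) (Q? : Decidable Q) →
            count (P? ∪? Q?) ≤ count P? + count Q?
count-∪-≤ {m = zero}  P? Q? = z≤n
count-∪-≤ {m = suc m} P? Q? with P? zero | Q? zero
... | yes _ | yes _ =
  s≤s (≤-trans (count-∪-≤ (P? ∘ suc) (Q? ∘ suc)) (+-monoʳ-≤ (count (P? ∘ suc)) (n≤1+n _)))
... | yes _ | no _  = s≤s (count-∪-≤ (P? ∘ suc) (Q? ∘ suc))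
... | no _  | yes _ =
  ≤-trans (s≤s (count-∪-≤ (P? ∘ suc) (Q? ∘ suc))) (≤-reflexive (sym (+-suc (count (P? ∘ suc)) _)))
... | no _  | no _  = count-∪-≤ (P? ∘ suc) (Q? ∘ suc)

count-∪ : {P : Pred (Fin m) ℓ₁} {Q : Pred (Fin m) ℓ₂} (P? : Decidable P) (Q? : Decidable Q) →
          P ⊥ Q → count (P? ∪? Q?) ≡ count P? + count Q?
count-∪ {m = zero}  P? Q? P⊥Q = refl
count-∪ {m = suc m} P? Q? P⊥Q with P? zero | Q? zero
... | yes p | yes q = ⊥-elim (P⊥Q (p , q))
... | yes _ | no _  = cong suc (count-∪ (P? ∘ suc) (Q? ∘ suc) P⊥Q)
... | no _  | yes _ =
  trans (cong suc (count-∪ (P? ∘ suc) (Q? ∘ suc) P⊥Q)) (sym (+-suc (count (P? ∘ suc)) _))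
... | no _  | no _  = count-∪ (P? ∘ suc) (Q? ∘ suc) P⊥Q

count-injective : {P : Pred (Fin m) ℓ} (P? : Decidable P) (e : Fin k → Fin m) →
                  Injective _≡_ _≡_ e → (∀ i → e i ∈ P) → k ≤ count P?
count-injective {k = zero}  P? e inj e∈P = z≤n
count-injective {k = suc k} {P = P} P? e inj e∈P = begin
  suc k                                       ≤⟨ s≤s (count-injective (P? ∩? ∁? (e zero ≟_)) (e ∘ suc)
                                                    (suc-injective ∘ inj) e∘suc∈P′) ⟩
  suc (count (P? ∩? ∁? (e zero ≟_)))          ≡⟨ count-remove P? (e∈P zero) ⟨
  count P?                                    ∎
  where
  open ≤-Reasoning
  e∘suc∈P′ : ∀ i → e (suc i) ∈ P ∩ ∁ (e zero ≡_)
  e∘suc∈P′ i = e∈P (suc i) , λ eq → 0≢1+n (inj eq)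

count-↑ : ∀ m {k} {P : Pred (Fin (m + k)) ℓ} (P? : Decidable P) →
          count P? ≡ count (λ i → P? (i ↑ˡ k)) + count (λ j → P? (m ↑ʳ j))
count-↑ zero    P? = refl
count-↑ (suc m) P? =
  trans (cong (head +_) (count-↑ m (P? ∘ suc))) (sym (+-assoc head _ _))
  where head = if does (P? zero) then 1 else 0

remQuot-↑ʳ : (j : Fin (m * k)) → remQuot {suc m} k (k ↑ʳ j) ≡ map₁ suc (remQuot {m} k j)
remQuot-↑ʳ {m} {k} j rewrite splitAt-↑ʳ k (m * k) j = refl

count-× : {P : Pred (Fin m) ℓ₁} {Q : Pred (Fin k) ℓ₂} (P? : Decidable P) (Q? : Decidable Q) →
          count ((P? ×? Q?) ∘ remQuot {m} k) ≡ count P? * count Q?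
count-× {m = zero}      P? Q? = refl
count-× {m = suc m} {k = k} {P = P} {Q = Q} P? Q? = begin
  count ((P? ×? Q?) ∘ remQuot k)
    ≡⟨ count-↑ k ((P? ×? Q?) ∘ remQuot k) ⟩
  count (λ j → (P? ×? Q?) (remQuot k (j ↑ˡ m * k))) + count (λ j → (P? ×? Q?) (remQuot k (k ↑ʳ j)))
    ≡⟨ cong₂ _+_ firstRow otherRows ⟩
  head * count Q? + count (P? ∘ suc) * count Q?
    ≡⟨ *-distribʳ-+ (count Q?) head _ ⟨
  count P? * count Q? ∎
  where
  open ≡-Reasoning
  head = if does (P? zero) then 1 else 0
  remQuot-↑ˡ : ∀ j → remQuot {suc m} k (j ↑ˡ m * k) ≡ (zero , j)
  remQuot-↑ˡ = remQuot-combine zero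
  firstRow : count (λ j → (P? ×? Q?) (remQuot k (j ↑ˡ m * k))) ≡ head * count Q?
  firstRow with P? zero
  ... | yes p = trans (count-cong _ Q? (λ {j} h → proj₂ (subst (P ⟨×⟩ Q) (remQuot-↑ˡ j) h))
                                        (λ {j} q → subst (P ⟨×⟩ Q) (sym (remQuot-↑ˡ j)) (p , q)))
                      (sym (+-identityʳ (count Q?)))
  ... | no ¬p = count-empty _ λ j h → ¬p (proj₁ (subst (P ⟨×⟩ Q) (remQuot-↑ˡ j) h))
  otherRows : count (λ j → (P? ×? Q?) (remQuot k (k ↑ʳ j))) ≡ count (P? ∘ suc) * count Q?
  otherRows = trans (count-cong _ ((P? ∘ suc ×? Q?) ∘ remQuot {m} k)
                      (λ {j} h → subst (P ⟨×⟩ Q) (remQuot-↑ʳ j) h)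
                      (λ {j} h → subst (P ⟨×⟩ Q) (sym (remQuot-↑ʳ j)) h))
                    (count-× (P? ∘ suc) Q?)

count-insert : {P : Pred (Fin m) ℓ} (P? : Decidable P) {x : Fin m} → x ∉ P →
               count ((x ≟_) ∪? P?) ≡ suc (count P?)
count-insert P? {x} x∉P =
  trans (count-∪ (x ≟_) P? λ { (refl , x∈P) → x∉P x∈P }) (cong (_+ count P?) (count-singleton x))

count>0⇒satisfiable : {X : Pred (Fin m) ℓ} (X? : Decidable X) → 0 < count X? → Satisfiable X
count>0⇒satisfiable X? 0<count with any? X?
... | yes x∈X = x∈X
... | no empty = contradiction (subst (0 <_) (count-empty X? λ x x∈X → empty (x , x∈X)) 0<count) λ ()

does≡true⇒ : ∀ {a} {A : Set a} (A? : Dec A) → does A? ≡ true → A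
does≡true⇒ (yes a) _ = a

T-does : ∀ {a} {A : Set a} (A? : Dec A) → A → T (does A?)
T-does A? a = subst T (sym (dec-true A? a)) tt

T-∧⁺ : ∀ {a b} → T a × T b → T (a ∧ b)
T-∧⁺ = Equivalence.from Bool.T-∧

Nbhd : (G : Graph) → Fin (n G) → Pred (Fin (n G)) 0ℓ
Nbhd G v u = T (adj G v u)

Nbhd? : (G : Graph) (v : Fin (n G)) → Decidable (Nbhd G v)
Nbhd? G v u = T? (adj G v u)

ClosedNbhd : (G : Graph) → Fin (n G) → Pred (Fin (n G)) 0ℓ
ClosedNbhd G v = ｛ v ｝ ∪ Nbhd G v

ClosedNbhd? : (G : Graph) (v : Fin (n G)) → Decidable (ClosedNbhd G v)
ClosedNbhd? G v = (v ≟_) ∪? Nbhd? G v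

Nbhd-irrefl : (G : Graph) (v : Fin (n G)) → v ∉ Nbhd G v
Nbhd-irrefl G v v∼v = subst T (adj-irr G v) v∼v

Nbhd-sym : (G : Graph) {u v : Fin (n G)} → v ∈ Nbhd G u → u ∈ Nbhd G v
Nbhd-sym G {u} {v} = subst T (adj-sym G u v)

∣tabulate∣≡count : (b : Fin m → Bool) → ∣ tabulate b ∣ ≡ count (T? ∘ b)
∣tabulate∣≡count {m = zero}  b = refl
∣tabulate∣≡count {m = suc m} b with b zero
... | true  = cong suc (∣tabulate∣≡count (b ∘ suc))
... | false = ∣tabulate∣≡count (b ∘ suc)

deg≡count : (G : Graph) (v : Fin (n G)) → deg G v ≡ count (Nbhd? G v)
deg≡count G v = ∣tabulate∣≡count (adj G v)

count-ClosedNbhd : (G : Graph) (v : Fin (n G)) → count (ClosedNbhd? G v) ≡ suc (deg G v)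
count-ClosedNbhd G v = begin
  count (ClosedNbhd? G v)              ≡⟨ count-∪ (v ≟_) (Nbhd? G v) (λ { (refl , v∼v) → Nbhd-irrefl G v v∼v }) ⟩
  count (v ≟_) + count (Nbhd? G v)     ≡⟨ cong₂ _+_ (count-singleton v) (sym (deg≡count G v)) ⟩
  suc (deg G v)                        ∎
  where open ≡-Reasoning

degreeIn : (G : Graph) {X : Pred (Fin (n G)) ℓ} → Decidable X → Fin (n G) → ℕ
degreeIn G X? v = count (X? ∩? Nbhd? G v)

count-∩-ClosedNbhd : (G : Graph) {X : Pred (Fin (n G)) ℓ} (X? : Decidable X) {v : Fin (n G)} → v ∈ X →
                     count (X? ∩? ClosedNbhd? G v) ≡ suc (degreeIn G X? v)
count-∩-ClosedNbhd G X? {v} v∈X = trans (count-remove (X? ∩? ClosedNbhd? G v) (v∈X , inj₁ refl))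
  (cong suc (count-cong _ (X? ∩? Nbhd? G v)
    (λ { ((w∈X , inj₁ v≡w) , v≢w) → contradiction v≡w v≢w ; ((w∈X , inj₂ v∼w) , _) → w∈X , v∼w })
    (λ { (w∈X , v∼w) → (w∈X , inj₂ v∼w) , λ { refl → Nbhd-irrefl G v v∼w } })))

MinDegAtLeast : (G : Graph) {X : Pred (Fin (n G)) ℓ} → Decidable X → ℕ → Set ℓ
MinDegAtLeast G {X} X? k = ∀ {v} → v ∈ X → k ≤ degreeIn G X? v

record Core (G : Graph) (k : ℕ) : Set₁ where
  field
    {Members} : Pred (Fin (n G)) 0ℓ
    members?  : Decidable Members
    nonempty  : Satisfiable Members
    dense     : MinDegAtLeast G members? k

induced : (G : Graph) {X : Pred (Fin (n G)) ℓ} → Decidable X → Subgraph G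
induced G X? = record
  { inV     = λ v → does (X? v)
  ; inE     = edge
  ; inE-adj = λ u v e → proj₂ (∧-true e)
  ; inE-V   = λ u v e → ∧-true (proj₁ (∧-true e))
  ; inE-sym = λ u v → cong₂ _∧_ (Bool.∧-comm (does (X? u)) (does (X? v))) (adj-sym G u v)
  }
  where
  edge : Fin (n G) → Fin (n G) → Bool
  edge u v = (does (X? u) ∧ does (X? v)) ∧ adj G u v
  ∧-true : ∀ {a b} → a ∧ b ≡ true → a ≡ true × b ≡ true
  ∧-true {true} e = refl , e

degreeIn≤degH-induced : (G : Graph) {X : Pred (Fin (n G)) ℓ} (X? : Decidable X) {v : Fin (n G)} →
                        v ∈ X → degreeIn G X? v ≤ degH (induced G X?) v
degreeIn≤degH-induced G {X} X? {v} v∈X = begin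
  degreeIn G X? v                     ≤⟨ count-mono (X? ∩? Nbhd? G v) (T? ∘ inE (induced G X?) v) edge ⟩
  count (T? ∘ inE (induced G X?) v)   ≡⟨ ∣tabulate∣≡count (inE (induced G X?) v) ⟨
  degH (induced G X?) v               ∎
  where
  open ≤-Reasoning
  edge : ∀ {u} → u ∈ X × u ∈ Nbhd G v → T (inE (induced G X?) v u)
  edge {u} (u∈X , v∼u) = T-∧⁺ (T-∧⁺ (T-does (X? v) v∈X , T-does (X? u) u∈X) , v∼u)

lowDegreeVertex : EveryMinDegAtMost G d → {X : Pred (Fin (n G)) ℓ} (X? : Decidable X) →
                  Satisfiable X → ∃ λ v → v ∈ X × degreeIn G X? v ≤ d
lowDegreeVertex {G = G} everyMinDeg X? (v , v∈X)
  with everyMinDeg (induced G X?) (v , dec-true (X? v) v∈X)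
... | w , w∈H , degH≤d = w , w∈X , ≤-trans (degreeIn≤degH-induced G X? w∈X) degH≤d
  where w∈X = does≡true⇒ (X? w) w∈H

core-weaken : {k′ : ℕ} → k′ ≤ k → Core G k → Core G k′
core-weaken k′≤k core = record
  { members? = Core.members? core ; nonempty = Core.nonempty core ; dense = ≤-trans k′≤k ∘ Core.dense core }

core⇒≤ : Core G k → EveryMinDegAtMost G d → k ≤ d
core⇒≤ core everyMinDeg with lowDegreeVertex everyMinDeg (Core.members? core) (Core.nonempty core)
... | v , v∈X , low = ≤-trans (Core.dense core v∈X) low

degH≤degreeIn : (H : Subgraph G) {X : Pred (Fin (n G)) ℓ} (X? : Decidable X) →
                (∀ v → inV H v ≡ true → v ∈ X) → ∀ v → degH H v ≤ degreeIn G X? v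
degH≤degreeIn {G = G} H {X} X? H⊆X v = begin
  degH H v                    ≡⟨ ∣tabulate∣≡count (inE H v) ⟩
  count (T? ∘ inE H v)        ≤⟨ count-mono (T? ∘ inE H v) (X? ∩? Nbhd? G v) edge⇒ ⟩
  degreeIn G X? v             ∎
  where
  open ≤-Reasoning
  edge⇒ : ∀ {u} → T (inE H v u) → u ∈ X × u ∈ Nbhd G v
  edge⇒ {u} e = H⊆X u (proj₂ (inE-V H v u e′)) , subst T (sym (inE-adj H v u e′)) tt
    where e′ = Equivalence.to Bool.T-≡ e

-- Repeatedly deleting a vertex of degree at most k either empties X, in which
-- case every subgraph inside X has such a vertex, or stops at a core.
peel : (G : Graph) (k : ℕ) {X : Pred (Fin (n G)) 0ℓ} (X? : Decidable X) (c : ℕ) → count X? ≡ c →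
       Core G (suc k) ⊎
       ((H : Subgraph G) → Nonempty H → (∀ v → inV H v ≡ true → v ∈ X) → MinDegAtMost H k)
peel G k X? c count≡c with any? (λ v → X? v ×-dec (degreeIn G X? v ≤? k))
peel G k X? c count≡c | no noLow with any? X?
... | yes nonempty = inj₁ (record { members? = X? ; nonempty = nonempty
                                   ; dense = λ v∈X → ≰⇒> (λ low → noLow (_ , v∈X , low)) })
... | no empty = inj₂ λ H (v , v∈H) H⊆X → contradiction (v , H⊆X v v∈H) empty
peel G k X? zero count≡0 | yes (v , v∈X , low) =
  contradiction (trans (sym (count-remove X? v∈X)) count≡0) λ ()
peel G k {X} X? (suc c) count≡c | yes (v , v∈X , low)
  with peel G k (X? ∩? ∁? (v ≟_)) c (ℕ.suc-injective (trans (sym (count-remove X? v∈X)) count≡c))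
... | inj₁ core = inj₁ core
... | inj₂ rest = inj₂ λ H nonempty H⊆X → choose H nonempty H⊆X (inV H v) refl
  where
  choose : (H : Subgraph G) → Nonempty H → (∀ w → inV H w ≡ true → w ∈ X) →
           (b : Bool) → inV H v ≡ b → MinDegAtMost H k
  choose H _ H⊆X true v∈H = v , v∈H , ≤-trans (degH≤degreeIn H X? H⊆X v) low
  choose H nonempty H⊆X false v∉H =
    rest H nonempty λ w w∈H → H⊆X w w∈H , λ { refl → contradiction (trans (sym v∉H) w∈H) λ () }

degeneracy⇒core : IsDegeneracy G d → Fin (n G) → Core G d
degeneracy⇒core {d = zero} _ v = record { members? = v ≟_ ; nonempty = v , refl ; dense = λ _ → z≤n }
degeneracy⇒core {G = G} {d = suc k} (_ , least) _
  with peel G k U? (count (U? {A = Fin (n G)})) refl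
... | inj₁ core = core
... | inj₂ every = contradiction (least k λ H nonempty → every H nonempty λ _ _ → tt) 1+n≰n

maxDegreeVertex : {Δ : ℕ} → IsMaxDegree G Δ → Fin (n G) → ∃ λ v → Δ ≤ deg G v
maxDegreeVertex {G = G} (_ , least) v₀ =
  v , least (deg G v) λ u → All.lookup (f[xs]≤f[argmax] v₀ (allFin (n G))) (∈-allFin u)
  where v = argmax (deg G) v₀ (allFin (n G))

record Biclique (G : Graph) (s t : ℕ) : Set₁ where
  field
    {Left Right}  : Pred (Fin (n G)) 0ℓ
    left?         : Decidable Left
    right?        : Decidable Right
    count-left    : s ≤ count left?
    count-right   : t ≤ count right?
    complete      : ∀ {u w} → u ∈ Left → w ∈ Right → w ∈ Nbhd G u
    disjoint      : ∀ {u} → u ∈ Left → u ∉ Right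

  complete′ : ∀ {u w} → u ∈ Right → w ∈ Left → w ∈ Nbhd G u
  complete′ u∈R w∈L = Nbhd-sym G (complete w∈L u∈R)

  left-nonempty : 0 < s → Satisfiable Left
  left-nonempty 0<s = count>0⇒satisfiable left? (≤-trans 0<s count-left)

  right-nonempty : 0 < t → Satisfiable Right
  right-nonempty 0<t = count>0⇒satisfiable right? (≤-trans 0<t count-right)

  t≤deg-left : ∀ {u} → u ∈ Left → t ≤ deg G u
  t≤deg-left {u} u∈L = ≤-trans count-right
    (≤-trans (count-mono right? (Nbhd? G u) (complete u∈L)) (≤-reflexive (sym (deg≡count G u))))

biclique : {s t : ℕ} → ContainsKst G s t → Biclique G s t
biclique {G = G} (a , b , a-inj , b-inj , a≢b , a∼b) = record
  { left?       = λ v → any? λ i → a i ≟ v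
  ; right?      = λ v → any? λ j → b j ≟ v
  ; count-left  = count-injective _ a (λ {i i′} → a-inj i i′) λ i → i , refl
  ; count-right = count-injective _ b (λ {j j′} → b-inj j j′) λ j → j , refl
  ; complete    = λ { (i , refl) (j , refl) → subst T (sym (a∼b i j)) tt }
  ; disjoint    = λ { (i , refl) (j , a≡b) → a≢b i j (sym a≡b) }
  }

biclique⇒core : {s t : ℕ} → 0 < s → s ≤ t → Biclique G s t → Core G s
biclique⇒core {G = G} 0<s s≤t K = record
  { members? = left? ∪? right?
  ; nonempty = let (u , u∈L) = left-nonempty 0<s in u , inj₁ u∈L
  ; dense    = λ { (inj₁ u∈L) → ≤-trans s≤t (≤-trans count-right
                                  (count-mono right? _ λ w∈R → inj₂ w∈R , complete u∈L w∈R))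
                 ; (inj₂ u∈R) → ≤-trans count-left
                                  (count-mono left? _ λ w∈L → inj₁ w∈L , complete′ u∈R w∈L) }
  }
  where open Biclique K

-- G read as a spanning subgraph of G₁ ⊠ G₂.  Abstracting over the reading lets
-- the upper bound be applied to the strong product with the factors swapped.
record Coordinates (G G₁ G₂ : Graph) : Set₁ where
  field
    split       : Fin (n G) → Fin (n G₁) × Fin (n G₂)
    pair        : Fin (n G₁) → Fin (n G₂) → Fin (n G)
    split-pair  : ∀ a u → split (pair a u) ≡ (a , u)
    pair-split  : ∀ x → uncurry pair (split x) ≡ x
    count-split : {P : Pred (Fin (n G₁)) 0ℓ} {Q : Pred (Fin (n G₂)) 0ℓ}
                  (P? : Decidable P) (Q? : Decidable Q) →
                  count ((P? ×? Q?) ∘ split) ≡ count P? * count Q?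
    Nbhd-split  : ∀ {x y} → y ∈ Nbhd G x →
                  split y ∈ (ClosedNbhd G₁ (proj₁ (split x)) ⟨×⟩ ClosedNbhd G₂ (proj₂ (split x)))

  infixr 7 _⊗_ _⊗?_

  _⊗_ : Pred (Fin (n G₁)) 0ℓ → Pred (Fin (n G₂)) 0ℓ → Pred (Fin (n G)) 0ℓ
  P ⊗ Q = split ⊢ (P ⟨×⟩ Q)

  _⊗?_ : {P : Pred (Fin (n G₁)) 0ℓ} {Q : Pred (Fin (n G₂)) 0ℓ} →
         Decidable P → Decidable Q → Decidable (P ⊗ Q)
  P? ⊗? Q? = (P? ×? Q?) ∘ split

  ⊗-pair⁻ : ∀ {P Q a u} → pair a u ∈ P ⊗ Q → a ∈ P × u ∈ Q
  ⊗-pair⁻ {P} {Q} {a} {u} = subst (P ⟨×⟩ Q) (split-pair a u)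

  ⊗-pair⁺ : ∀ {P Q a u} → a ∈ P → u ∈ Q → pair a u ∈ P ⊗ Q
  ⊗-pair⁺ {P} {Q} {a} {u} a∈P u∈Q = subst (P ⟨×⟩ Q) (sym (split-pair a u)) (a∈P , u∈Q)

  pair-split′ : ∀ {x a u} → split x ≡ (a , u) → pair a u ≡ x
  pair-split′ {x} eq = trans (cong (uncurry pair) (sym eq)) (pair-split x)

  Nbhd-pair-split : ∀ {a u y} → y ∈ Nbhd G (pair a u) → split y ∈ (ClosedNbhd G₁ a ⟨×⟩ ClosedNbhd G₂ u)
  Nbhd-pair-split {a} {u} {y} x∼y =
    subst (λ p → split y ∈ (ClosedNbhd G₁ (proj₁ p) ⟨×⟩ ClosedNbhd G₂ (proj₂ p)))
          (split-pair a u) (Nbhd-split x∼y)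

module _ {G G₁ G₂ : Graph} (coords : Coordinates G G₁ G₂) (H : Subgraph G) where
  open Coordinates coords

  private
    InH : Pred (Fin (n G)) 0ℓ
    InH x = inV H x ≡ true

    InH? : Decidable InH
    InH? x = inV H x Bool.≟ true

    edge⇒Nbhd : ∀ {x y} → T (inE H x y) → y ∈ Nbhd G x
    edge⇒Nbhd {x} {y} e = subst T (sym (inE-adj H x y (Equivalence.to Bool.T-≡ e))) tt

    edge⇒InH : ∀ {x y} → T (inE H x y) → y ∈ InH
    edge⇒InH {x} {y} e = proj₂ (inE-V H x y (Equivalence.to Bool.T-≡ e))

  Shadow : Pred (Fin (n G₁)) 0ℓ
  Shadow a = ∃ λ u → pair a u ∈ InH

  shadow? : Decidable Shadow
  shadow? a = any? λ u → InH? (pair a u)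

  Fibre : Fin (n G₁) → Pred (Fin (n G₂)) 0ℓ
  Fibre a u = pair a u ∈ InH

  fibre? : (a : Fin (n G₁)) → Decidable (Fibre a)
  fibre? a u = InH? (pair a u)

  shadow-nonempty : Nonempty H → Satisfiable Shadow
  shadow-nonempty (x , x∈H) = proj₁ (split x) , proj₂ (split x) , subst InH (sym (pair-split x)) x∈H

  Nbhd-pair⊆ : ∀ a u → (T ∘ inE H (pair a u)) ⊆
               (｛ a ｝ ⊗ (Fibre a ∩ Nbhd G₂ u)) ∪ ((Shadow ∩ Nbhd G₁ a) ⊗ ClosedNbhd G₂ u)
  Nbhd-pair⊆ a u {y} e with split y in split-y | Nbhd-pair-split (edge⇒Nbhd e)
  ... | b , w | inj₁ refl , inj₁ refl =
    contradiction (subst (Nbhd G (pair a u)) (sym (pair-split′ split-y)) (edge⇒Nbhd e))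
                  (Nbhd-irrefl G (pair a u))
  ... | b , w | inj₁ refl , inj₂ u∼w =
    inj₁ (refl , subst InH (sym (pair-split′ split-y)) (edge⇒InH e) , u∼w)
  ... | b , w | inj₂ a∼b , w∈N[u] =
    inj₂ (((w , subst InH (sym (pair-split′ split-y)) (edge⇒InH e)) , a∼b) , w∈N[u])

  degH-pair≤ : ∀ a u →
               degH H (pair a u) ≤ degreeIn G₂ (fibre? a) u + degreeIn G₁ shadow? a * suc (deg G₂ u)
  degH-pair≤ a u = begin
    degH H (pair a u)                   ≡⟨ ∣tabulate∣≡count (inE H (pair a u)) ⟩
    count (T? ∘ inE H (pair a u))       ≤⟨ count-mono _ (R₁? ∪? R₂?) (Nbhd-pair⊆ a u) ⟩
    count (R₁? ∪? R₂?)                  ≤⟨ count-∪-≤ R₁? R₂? ⟩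
    count R₁? + count R₂?               ≡⟨ cong₂ _+_ (count-split (a ≟_) _) (count-split _ (ClosedNbhd? G₂ u)) ⟩
    count (a ≟_) * δᶠ + δˢ * count (ClosedNbhd? G₂ u)
                                        ≡⟨ cong₂ (λ c c′ → c * δᶠ + δˢ * c′) (count-singleton a) (count-ClosedNbhd G₂ u) ⟩
    1 * δᶠ + δˢ * suc (deg G₂ u)        ≡⟨ cong (_+ δˢ * suc (deg G₂ u)) (*-identityˡ δᶠ) ⟩
    δᶠ + δˢ * suc (deg G₂ u)            ∎
    where
    open ≤-Reasoning
    δᶠ = degreeIn G₂ (fibre? a) u
    δˢ = degreeIn G₁ shadow? a
    R₁? = (a ≟_) ⊗? (fibre? a ∩? Nbhd? G₂ u)
    R₂? = (shadow? ∩? Nbhd? G₁ a) ⊗? ClosedNbhd? G₂ u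

everyMinDegAtMost-⊠ : {G G₁ G₂ : Graph} {d₁ d₂ Δ₂ : ℕ} → Coordinates G G₁ G₂ →
                      EveryMinDegAtMost G₁ d₁ → EveryMinDegAtMost G₂ d₂ → (∀ v → deg G₂ v ≤ Δ₂) →
                      EveryMinDegAtMost G (d₁ + d₂ + d₁ * Δ₂)
everyMinDegAtMost-⊠ {G} {G₁} {G₂} {d₁} {d₂} {Δ₂} coords everyMinDeg₁ everyMinDeg₂ deg≤Δ₂ H nonempty
  with a , a∈shadow , low-a ← lowDegreeVertex everyMinDeg₁ (shadow? coords H)
                                (shadow-nonempty coords H nonempty)
  with u , u∈fibre , low-u ← lowDegreeVertex everyMinDeg₂ (fibre? coords H a) a∈shadow
  = pair a u , u∈fibre , (begin
    degH H (pair a u)                                    ≤⟨ degH-pair≤ coords H a u ⟩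
    degreeIn G₂ (fibre? coords H a) u + degreeIn G₁ (shadow? coords H) a * suc (deg G₂ u)
                                                         ≤⟨ +-mono-≤ low-u (*-mono-≤ low-a (s≤s (deg≤Δ₂ u))) ⟩
    d₂ + d₁ * suc Δ₂                                     ≡⟨ solve 3 (λ d₁ d₂ Δ₂ → d₂ :+ d₁ :* (con 1 :+ Δ₂)
                                                                          := d₁ :+ d₂ :+ d₁ :* Δ₂) refl d₁ d₂ Δ₂ ⟩
    d₁ + d₂ + d₁ * Δ₂                                    ∎)
  where
  open Coordinates coords
  open ≤-Reasoning
  open +-*-Solver

module StrongProduct (G₁ G₂ : Graph) where

  private
    V = Fin (n G₁ * n G₂)

    T-eqb⁻ : ∀ {m} {a b : Fin m} → T (eqb a b) → a ≡ b
    T-eqb⁻ {a = a} {b} t with a ≟ b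
    ... | yes a≡b = a≡b

    ClosedNbhd⁻ : (G : Graph) {a b : Fin (n G)} → T (eqb a b ∨ adj G a b) → b ∈ ClosedNbhd G a
    ClosedNbhd⁻ G {a} {b} t = Sum.map T-eqb⁻ id (Equivalence.to Bool.T-∨ t)

    ClosedNbhd⁺ : (G : Graph) {a b : Fin (n G)} → b ∈ ClosedNbhd G a → T (eqb a b ∨ adj G a b)
    ClosedNbhd⁺ G {a} (inj₁ refl) = subst (λ c → T (c ∨ adj G a a)) (sym (eqb-refl a)) tt
    ClosedNbhd⁺ G (inj₂ a∼b)      = Equivalence.from Bool.T-∨ (inj₂ a∼b)

  standard : Coordinates (G₁ ⊠ G₂) G₁ G₂
  standard = record
    { split       = remQuot (n G₂)
    ; pair        = combine
    ; split-pair  = remQuot-combine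
    ; pair-split  = combine-remQuot {n G₁} (n G₂)
    ; count-split = count-×
    ; Nbhd-split  = λ {x} {y} x∼y → let (_ , a∼b , u∼w) = T-∧⁻ {not (eqb x y)} x∼y
                                     in ClosedNbhd⁻ G₁ a∼b , ClosedNbhd⁻ G₂ u∼w
    }
    where
    T-∧⁻ : ∀ {a b c} → T (a ∧ b ∧ c) → T a × T b × T c
    T-∧⁻ t = let (ta , tbc) = Equivalence.to Bool.T-∧ t in ta , Equivalence.to Bool.T-∧ tbc

  swapped : Coordinates (G₁ ⊠ G₂) G₂ G₁
  swapped = record
    { split       = swap ∘ split
    ; pair        = λ u a → pair a u
    ; split-pair  = λ u a → cong swap (split-pair a u)
    ; pair-split  = pair-split
    ; count-split = λ P? Q? → trans (count-cong _ ((Q? ×? P?) ∘ split) swap swap)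
                                    (trans (count-split Q? P?) (*-comm (count Q?) (count P?)))
    ; Nbhd-split  = swap ∘ Nbhd-split
    }
    where open Coordinates standard

  open Coordinates standard public using (pair; _⊗_; _⊗?_; ⊗-pair⁻; ⊗-pair⁺)
  open Coordinates standard using (split; split-pair; pair-split)

  ⊠-Nbhd⁺ : ∀ {a u y} → pair a u ≢ y → y ∈ ClosedNbhd G₁ a ⊗ ClosedNbhd G₂ u →
            y ∈ Nbhd (G₁ ⊠ G₂) (pair a u)
  ⊠-Nbhd⁺ {a} {u} {y} x≢y (a∼b , u∼w) =
    subst (λ p → T (not (eqb (pair a u) y) ∧ pairAdj G₁ G₂ p (split y))) (sym (split-pair a u))
          (T-∧⁺ (subst (T ∘ not) (sym (dec-false (pair a u ≟ y) x≢y)) tt ,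
                 T-∧⁺ (ClosedNbhd⁺ G₁ a∼b , ClosedNbhd⁺ G₂ u∼w)))

  dense-pair : {X : Pred V 0ℓ} (X? : Decidable X) {k : ℕ} →
               (∀ {a u} → pair a u ∈ X → k ≤ degreeIn (G₁ ⊠ G₂) X? (pair a u)) →
               MinDegAtLeast (G₁ ⊠ G₂) X? k
  dense-pair {X} X? {k} dense {x} x∈X =
    subst (λ y → k ≤ degreeIn (G₁ ⊠ G₂) X? y) (pair-split x) (dense (subst X (sym (pair-split x)) x∈X))

  count≤degreeIn : {X Q : Pred V 0ℓ} (X? : Decidable X) (Q? : Decidable Q)
                   {a : Fin (n G₁)} {u : Fin (n G₂)} →
                   Q ⊆ X → Q ⊆ ClosedNbhd G₁ a ⊗ ClosedNbhd G₂ u → pair a u ∉ Q →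
                   count Q? ≤ degreeIn (G₁ ⊠ G₂) X? (pair a u)
  count≤degreeIn X? Q? {a} {u} Q⊆X Q⊆N x∉Q =
    count-mono Q? (X? ∩? Nbhd? (G₁ ⊠ G₂) (pair a u))
      λ y∈Q → Q⊆X y∈Q , ⊠-Nbhd⁺ (λ { refl → x∉Q y∈Q }) (Q⊆N y∈Q)

  record NbhdRectangle (X : Pred V 0ℓ) (a : Fin (n G₁)) (u : Fin (n G₂)) : Set₁ where
    field
      {Side₁}       : Pred (Fin (n G₁)) 0ℓ
      {Side₂}       : Pred (Fin (n G₂)) 0ℓ
      side₁?        : Decidable Side₁
      side₂?        : Decidable Side₂
      ⊆members      : Side₁ ⊗ Side₂ ⊆ X
      ⊆ClosedNbhd₁  : Side₁ ⊆ ClosedNbhd G₁ a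
      ⊆ClosedNbhd₂  : Side₂ ⊆ ClosedNbhd G₂ u
      avoids-centre : a ∉ Side₁ ⊎ u ∉ Side₂

    area : ℕ
    area = count side₁? * count side₂?

    ∌centre : pair a u ∉ Side₁ ⊗ Side₂
    ∌centre x∈R with ⊗-pair⁻ {Side₁} {Side₂} x∈R | avoids-centre
    ... | a∈S₁ , _ | inj₁ a∉S₁ = a∉S₁ a∈S₁
    ... | _ , u∈S₂ | inj₂ u∉S₂ = u∉S₂ u∈S₂

    ⊆ClosedNbhd : Side₁ ⊗ Side₂ ⊆ ClosedNbhd G₁ a ⊗ ClosedNbhd G₂ u
    ⊆ClosedNbhd = map ⊆ClosedNbhd₁ ⊆ClosedNbhd₂

  open NbhdRectangle

  area≤degreeIn : {X : Pred V 0ℓ} (X? : Decidable X) {a : Fin (n G₁)} {u : Fin (n G₂)} →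
                  (R : NbhdRectangle X a u) → area R ≤ degreeIn (G₁ ⊠ G₂) X? (pair a u)
  area≤degreeIn X? {a} {u} R = begin
    area R                                  ≡⟨ count-× (side₁? R) (side₂? R) ⟨
    count (side₁? R ⊗? side₂? R)            ≤⟨ count≤degreeIn X? _ (⊆members R) (⊆ClosedNbhd R) (∌centre R) ⟩
    degreeIn (G₁ ⊠ G₂) X? (pair a u)        ∎
    where open ≤-Reasoning

  area+area≤degreeIn : {X : Pred V 0ℓ} (X? : Decidable X) {a : Fin (n G₁)} {u : Fin (n G₂)} →
                       (R R′ : NbhdRectangle X a u) → (∀ {b} → b ∈ Side₁ R → b ∉ Side₁ R′) →
                       area R + area R′ ≤ degreeIn (G₁ ⊠ G₂) X? (pair a u)
  area+area≤degreeIn X? {a} {u} R R′ disjoint = begin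
    area R + area R′
      ≡⟨ cong₂ _+_ (count-× (side₁? R) (side₂? R)) (count-× (side₁? R′) (side₂? R′)) ⟨
    count R? + count R′?
      ≡⟨ count-∪ R? R′? (λ (y∈R , y∈R′) → disjoint (proj₁ y∈R) (proj₁ y∈R′)) ⟨
    count (R? ∪? R′?)
      ≤⟨ count≤degreeIn X? (R? ∪? R′?) [ ⊆members R , ⊆members R′ ]
                                       [ ⊆ClosedNbhd R , ⊆ClosedNbhd R′ ] [ ∌centre R , ∌centre R′ ] ⟩
    degreeIn (G₁ ⊠ G₂) X? (pair a u)  ∎
    where
    open ≤-Reasoning
    R? = side₁? R ⊗? side₂? R
    R′? = side₁? R′ ⊗? side₂? R′

  core-⊗ : {δ₁ δ₂ : ℕ} → Core G₁ δ₁ → Core G₂ δ₂ → Core (G₁ ⊠ G₂) (δ₁ + δ₂ + δ₁ * δ₂)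
  core-⊗ {δ₁} {δ₂} C₁ C₂ = record
    { members? = Y₁? ⊗? Y₂?
    ; nonempty = let (a , a∈Y₁) = C₁.nonempty ; (u , u∈Y₂) = C₂.nonempty
                 in pair a u , ⊗-pair⁺ {C₁.Members} {C₂.Members} a∈Y₁ u∈Y₂
    ; dense    = dense-pair (Y₁? ⊗? Y₂?) dense
    }
    where
    module C₁ = Core C₁
    module C₂ = Core C₂
    Y₁? = C₁.members?
    Y₂? = C₂.members?
    dense : ∀ {a u} → pair a u ∈ C₁.Members ⊗ C₂.Members →
            δ₁ + δ₂ + δ₁ * δ₂ ≤ degreeIn (G₁ ⊠ G₂) (Y₁? ⊗? Y₂?) (pair a u)
    dense {a} {u} x∈Y = ≤-pred (begin
      suc (δ₁ + δ₂ + δ₁ * δ₂)                           ≡⟨ solve 2 (λ δ₁ δ₂ → con 1 :+ (δ₁ :+ δ₂ :+ δ₁ :* δ₂)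
                                                                        := (con 1 :+ δ₁) :* (con 1 :+ δ₂)) refl δ₁ δ₂ ⟩
      suc δ₁ * suc δ₂                                   ≤⟨ *-mono-≤ (s≤s (C₁.dense a∈Y₁)) (s≤s (C₂.dense u∈Y₂)) ⟩
      suc (degreeIn G₁ Y₁? a) * suc (degreeIn G₂ Y₂? u) ≡⟨ cong₂ _*_ (count-∩-ClosedNbhd G₁ Y₁? a∈Y₁)
                                                                     (count-∩-ClosedNbhd G₂ Y₂? u∈Y₂) ⟨
      count N₁? * count N₂?                             ≡⟨ count-× N₁? N₂? ⟨
      count (N₁? ⊗? N₂?)                                ≡⟨ count-remove (N₁? ⊗? N₂?)
                                                             (⊗-pair⁺ {N₁} {N₂} (a∈Y₁ , inj₁ refl) (u∈Y₂ , inj₁ refl)) ⟩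
      suc (count ((N₁? ⊗? N₂?) ∩? ∁? (pair a u ≟_)))    ≤⟨ s≤s (count≤degreeIn (Y₁? ⊗? Y₂?) _
                                                              (map proj₁ proj₁ ∘ proj₁) (map proj₂ proj₂ ∘ proj₁)
                                                              λ (_ , x≢x) → x≢x refl) ⟩
      suc (degreeIn (G₁ ⊠ G₂) (Y₁? ⊗? Y₂?) (pair a u))  ∎)
      where
      open ≤-Reasoning
      open +-*-Solver
      a∈Y₁ = proj₁ (⊗-pair⁻ {C₁.Members} {C₂.Members} x∈Y)
      u∈Y₂ = proj₂ (⊗-pair⁻ {C₁.Members} {C₂.Members} x∈Y)
      N₁ = C₁.Members ∩ ClosedNbhd G₁ a
      N₂ = C₂.Members ∩ ClosedNbhd G₂ u
      N₁? : Decidable N₁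
      N₁? = Y₁? ∩? ClosedNbhd? G₁ a
      N₂? : Decidable N₂
      N₂? = Y₂? ∩? ClosedNbhd? G₂ u

  module _ {s₁ t₁ s₂ t₂ : ℕ} (K₁ : Biclique G₁ s₁ t₁) (K₂ : Biclique G₂ s₂ t₂) where
    private
      module K₁ = Biclique K₁
      module K₂ = Biclique K₂

    core-L⊗R∪R⊗L : 0 < s₁ → 0 < t₂ → Core (G₁ ⊠ G₂) ((s₁ * t₂) ⊓ (s₂ * t₁))
    core-L⊗R∪R⊗L 0<s₁ 0<t₂ = record
      { members? = X?
      ; nonempty = let (a , a∈L₁) = K₁.left-nonempty 0<s₁ ; (u , u∈R₂) = K₂.right-nonempty 0<t₂
                   in pair a u , inj₁ (⊗-pair⁺ {K₁.Left} {K₂.Right} a∈L₁ u∈R₂)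
      ; dense    = dense-pair X? dense
      }
      where
      X = (K₁.Left ⊗ K₂.Right) ∪ (K₁.Right ⊗ K₂.Left)
      X? : Decidable X
      X? = (K₁.left? ⊗? K₂.right?) ∪? (K₁.right? ⊗? K₂.left?)
      at-L⊗R : ∀ {a u} → a ∈ K₁.Left → u ∈ K₂.Right →
               (s₁ * t₂) ⊓ (s₂ * t₁) ≤ degreeIn (G₁ ⊠ G₂) X? (pair a u)
      at-L⊗R {a} {u} a∈L₁ u∈R₂ = begin
        (s₁ * t₂) ⊓ (s₂ * t₁)             ≤⟨ m⊓n≤n _ _ ⟩
        s₂ * t₁                           ≡⟨ *-comm s₂ t₁ ⟩
        t₁ * s₂                           ≤⟨ *-mono-≤ K₁.count-right K₂.count-left ⟩
        area R                            ≤⟨ area≤degreeIn X? R ⟩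
        degreeIn (G₁ ⊠ G₂) X? (pair a u)  ∎
        where
        open ≤-Reasoning
        R : NbhdRectangle X a u
        R = record { side₁? = K₁.right? ; side₂? = K₂.left? ; ⊆members = inj₂
                   ; ⊆ClosedNbhd₁ = inj₂ ∘ K₁.complete a∈L₁ ; ⊆ClosedNbhd₂ = inj₂ ∘ K₂.complete′ u∈R₂
                   ; avoids-centre = inj₁ (K₁.disjoint a∈L₁) }

      at-R⊗L : ∀ {a u} → a ∈ K₁.Right → u ∈ K₂.Left →
               (s₁ * t₂) ⊓ (s₂ * t₁) ≤ degreeIn (G₁ ⊠ G₂) X? (pair a u)
      at-R⊗L {a} {u} a∈R₁ u∈L₂ = begin
        (s₁ * t₂) ⊓ (s₂ * t₁)             ≤⟨ m⊓n≤m _ _ ⟩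
        s₁ * t₂                           ≤⟨ *-mono-≤ K₁.count-left K₂.count-right ⟩
        area R                            ≤⟨ area≤degreeIn X? R ⟩
        degreeIn (G₁ ⊠ G₂) X? (pair a u)  ∎
        where
        open ≤-Reasoning
        R : NbhdRectangle X a u
        R = record { side₁? = K₁.left? ; side₂? = K₂.right? ; ⊆members = inj₁
                   ; ⊆ClosedNbhd₁ = inj₂ ∘ K₁.complete′ a∈R₁ ; ⊆ClosedNbhd₂ = inj₂ ∘ K₂.complete u∈L₂
                   ; avoids-centre = inj₂ (K₂.disjoint u∈L₂) }

      dense : ∀ {a u} → pair a u ∈ X → (s₁ * t₂) ⊓ (s₂ * t₁) ≤ degreeIn (G₁ ⊠ G₂) X? (pair a u)
      dense (inj₁ x∈L⊗R) = uncurry at-L⊗R (⊗-pair⁻ {K₁.Left} {K₂.Right} x∈L⊗R)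
      dense (inj₂ x∈R⊗L) = uncurry at-R⊗L (⊗-pair⁻ {K₁.Right} {K₂.Left} x∈R⊗L)

    core-L⊗[L∪R]∪R⊗L : 0 < s₁ → 0 < s₂ →
                       Core (G₁ ⊠ G₂) ((t₁ + t₂) ⊓ (s₁ * (t₂ + 1)) ⊓ (s₂ * (t₁ + 1)))
    core-L⊗[L∪R]∪R⊗L 0<s₁ 0<s₂ = record
      { members? = X?
      ; nonempty = let (a , a∈L₁) = K₁.left-nonempty 0<s₁ ; (u , u∈L₂) = K₂.left-nonempty 0<s₂
                   in pair a u , inj₁ (⊗-pair⁺ {K₁.Left} {K₂.Left ∪ K₂.Right} a∈L₁ (inj₁ u∈L₂))
      ; dense    = dense-pair X? dense
      }
      where
      κ = (t₁ + t₂) ⊓ (s₁ * (t₂ + 1)) ⊓ (s₂ * (t₁ + 1))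
      X = (K₁.Left ⊗ (K₂.Left ∪ K₂.Right)) ∪ (K₁.Right ⊗ K₂.Left)
      X? : Decidable X
      X? = (K₁.left? ⊗? (K₂.left? ∪? K₂.right?)) ∪? (K₁.right? ⊗? K₂.left?)

      at-L⊗L : ∀ {a u} → a ∈ K₁.Left → u ∈ K₂.Left → κ ≤ degreeIn (G₁ ⊠ G₂) X? (pair a u)
      at-L⊗L {a} {u} a∈L₁ u∈L₂ = begin
        κ                                   ≤⟨ ≤-trans (m⊓n≤m _ _) (m⊓n≤m _ _) ⟩
        t₁ + t₂                             ≡⟨ +-comm t₁ t₂ ⟩
        t₂ + t₁                             ≤⟨ +-mono-≤ K₂.count-right K₁.count-right ⟩
        count K₂.right? + count K₁.right?   ≡⟨ cong₂ _+_ (*-identityˡ (count K₂.right?)) (*-identityʳ (count K₁.right?)) ⟨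
        1 * count K₂.right? + count K₁.right? * 1
                                            ≡⟨ cong₂ (λ c c′ → c * count K₂.right? + count K₁.right? * c′)
                                                     (count-singleton a) (count-singleton u) ⟨
        area R + area R′                    ≤⟨ area+area≤degreeIn X? R R′ (λ { refl b∈R₁ → K₁.disjoint a∈L₁ b∈R₁ }) ⟩
        degreeIn (G₁ ⊠ G₂) X? (pair a u)    ∎
        where
        open ≤-Reasoning
        R R′ : NbhdRectangle X a u
        R  = record { side₁? = a ≟_ ; side₂? = K₂.right?
                    ; ⊆members = λ (a≡b , w∈R₂) → inj₁ (subst K₁.Left a≡b a∈L₁ , inj₂ w∈R₂)
                    ; ⊆ClosedNbhd₁ = inj₁ ; ⊆ClosedNbhd₂ = inj₂ ∘ K₂.complete u∈L₂
                    ; avoids-centre = inj₂ (K₂.disjoint u∈L₂) }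
        R′ = record { side₁? = K₁.right? ; side₂? = u ≟_
                    ; ⊆members = λ (b∈R₁ , u≡w) → inj₂ (b∈R₁ , subst K₂.Left u≡w u∈L₂)
                    ; ⊆ClosedNbhd₁ = inj₂ ∘ K₁.complete a∈L₁ ; ⊆ClosedNbhd₂ = inj₁
                    ; avoids-centre = inj₁ (K₁.disjoint a∈L₁) }

      at-L⊗R : ∀ {a u} → a ∈ K₁.Left → u ∈ K₂.Right → κ ≤ degreeIn (G₁ ⊠ G₂) X? (pair a u)
      at-L⊗R {a} {u} a∈L₁ u∈R₂ = begin
        κ                                       ≤⟨ m⊓n≤n _ _ ⟩
        s₂ * (t₁ + 1)                           ≡⟨ trans (*-comm s₂ (t₁ + 1)) (cong (_* s₂) (+-comm t₁ 1)) ⟩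
        suc t₁ * s₂                             ≤⟨ *-mono-≤ (s≤s K₁.count-right) K₂.count-left ⟩
        suc (count K₁.right?) * count K₂.left?  ≡⟨ cong (_* count K₂.left?) (count-insert K₁.right? (K₁.disjoint a∈L₁)) ⟨
        area R                                  ≤⟨ area≤degreeIn X? R ⟩
        degreeIn (G₁ ⊠ G₂) X? (pair a u)        ∎
        where
        open ≤-Reasoning
        R : NbhdRectangle X a u
        R = record { side₁? = (a ≟_) ∪? K₁.right? ; side₂? = K₂.left?
                   ; ⊆members = λ { (inj₁ a≡b , w∈L₂) → inj₁ (subst K₁.Left a≡b a∈L₁ , inj₁ w∈L₂)
                                  ; (inj₂ b∈R₁ , w∈L₂) → inj₂ (b∈R₁ , w∈L₂) }
                   ; ⊆ClosedNbhd₁ = λ { (inj₁ a≡b) → inj₁ a≡b ; (inj₂ b∈R₁) → inj₂ (K₁.complete a∈L₁ b∈R₁) }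
                   ; ⊆ClosedNbhd₂ = inj₂ ∘ K₂.complete′ u∈R₂
                   ; avoids-centre = inj₂ λ u∈L₂ → K₂.disjoint u∈L₂ u∈R₂ }

      at-R⊗L : ∀ {a u} → a ∈ K₁.Right → u ∈ K₂.Left → κ ≤ degreeIn (G₁ ⊠ G₂) X? (pair a u)
      at-R⊗L {a} {u} a∈R₁ u∈L₂ = begin
        κ                                       ≤⟨ ≤-trans (m⊓n≤m _ _) (m⊓n≤n _ _) ⟩
        s₁ * (t₂ + 1)                           ≡⟨ cong (s₁ *_) (+-comm t₂ 1) ⟩
        s₁ * suc t₂                             ≤⟨ *-mono-≤ K₁.count-left (s≤s K₂.count-right) ⟩
        count K₁.left? * suc (count K₂.right?)  ≡⟨ cong (count K₁.left? *_) (count-insert K₂.right? (K₂.disjoint u∈L₂)) ⟨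
        area R                                  ≤⟨ area≤degreeIn X? R ⟩
        degreeIn (G₁ ⊠ G₂) X? (pair a u)        ∎
        where
        open ≤-Reasoning
        R : NbhdRectangle X a u
        R = record { side₁? = K₁.left? ; side₂? = (u ≟_) ∪? K₂.right?
                   ; ⊆members = λ { (b∈L₁ , inj₁ u≡w) → inj₁ (b∈L₁ , inj₁ (subst K₂.Left u≡w u∈L₂))
                                  ; (b∈L₁ , inj₂ w∈R₂) → inj₁ (b∈L₁ , inj₂ w∈R₂) }
                   ; ⊆ClosedNbhd₁ = inj₂ ∘ K₁.complete′ a∈R₁
                   ; ⊆ClosedNbhd₂ = λ { (inj₁ u≡w) → inj₁ u≡w ; (inj₂ w∈R₂) → inj₂ (K₂.complete u∈L₂ w∈R₂) }
                   ; avoids-centre = inj₁ λ a∈L₁ → K₁.disjoint a∈L₁ a∈R₁ }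

      dense : ∀ {a u} → pair a u ∈ X → κ ≤ degreeIn (G₁ ⊠ G₂) X? (pair a u)
      dense (inj₁ x∈X₁) with ⊗-pair⁻ {K₁.Left} {K₂.Left ∪ K₂.Right} x∈X₁
      ... | a∈L₁ , inj₁ u∈L₂ = at-L⊗L a∈L₁ u∈L₂
      ... | a∈L₁ , inj₂ u∈R₂ = at-L⊗R a∈L₁ u∈R₂
      dense (inj₂ x∈X₂) = uncurry at-R⊗L (⊗-pair⁻ {K₁.Right} {K₂.Left} x∈X₂)

  core-cross : (v₁ : Fin (n G₁)) (v₂ : Fin (n G₂)) → 0 < deg G₁ v₁ →
               Core (G₁ ⊠ G₂) (deg G₁ v₁ ⊓ deg G₂ v₂ + 1)
  core-cross v₁ v₂ 0<D₁ = record
    { members? = X?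
    ; nonempty = pair v₁ v₂ , inj₁ (⊗-pair⁺ {ClosedNbhd G₁ v₁} {｛ v₂ ｝} (inj₁ refl) refl)
    ; dense    = dense-pair X? dense
    }
    where
    D₁ = deg G₁ v₁
    D₂ = deg G₂ v₂
    X = (ClosedNbhd G₁ v₁ ⊗ ｛ v₂ ｝) ∪ (｛ v₁ ｝ ⊗ ClosedNbhd G₂ v₂)
    X? : Decidable X
    X? = (ClosedNbhd? G₁ v₁ ⊗? (v₂ ≟_)) ∪? ((v₁ ≟_) ⊗? ClosedNbhd? G₂ v₂)

    centre : D₁ ⊓ D₂ + 1 ≤ degreeIn (G₁ ⊠ G₂) X? (pair v₁ v₂)
    centre = begin
      D₁ ⊓ D₂ + 1                           ≤⟨ +-mono-≤ (m⊓n≤n D₁ D₂) 0<D₁ ⟩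
      D₂ + D₁                               ≡⟨ +-comm D₂ D₁ ⟩
      D₁ + D₂                               ≡⟨ cong₂ _+_ (deg≡count G₁ v₁) (deg≡count G₂ v₂) ⟩
      N₁ + N₂                               ≡⟨ cong₂ _+_ (*-identityʳ N₁) (*-identityˡ N₂) ⟨
      N₁ * 1 + 1 * N₂                       ≡⟨ cong₂ (λ c c′ → N₁ * c + c′ * N₂) (count-singleton v₂) (count-singleton v₁) ⟨
      area R + area R′                      ≤⟨ area+area≤degreeIn X? R R′ (λ { v₁∼b refl → Nbhd-irrefl G₁ v₁ v₁∼b }) ⟩
      degreeIn (G₁ ⊠ G₂) X? (pair v₁ v₂)    ∎
      where
      open ≤-Reasoning
      N₁ = count (Nbhd? G₁ v₁)
      N₂ = count (Nbhd? G₂ v₂)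
      R R′ : NbhdRectangle X v₁ v₂
      R  = record { side₁? = Nbhd? G₁ v₁ ; side₂? = v₂ ≟_
                  ; ⊆members = λ (v₁∼b , v₂≡w) → inj₁ (inj₂ v₁∼b , v₂≡w)
                  ; ⊆ClosedNbhd₁ = inj₂ ; ⊆ClosedNbhd₂ = inj₁
                  ; avoids-centre = inj₁ (Nbhd-irrefl G₁ v₁) }
      R′ = record { side₁? = v₁ ≟_ ; side₂? = Nbhd? G₂ v₂
                  ; ⊆members = λ (v₁≡b , v₂∼w) → inj₂ (v₁≡b , inj₂ v₂∼w)
                  ; ⊆ClosedNbhd₁ = inj₁ ; ⊆ClosedNbhd₂ = inj₂
                  ; avoids-centre = inj₂ (Nbhd-irrefl G₂ v₂) }

    beside₁ : ∀ {a} → a ∈ Nbhd G₁ v₁ → D₁ ⊓ D₂ + 1 ≤ degreeIn (G₁ ⊠ G₂) X? (pair a v₂)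
    beside₁ {a} v₁∼a = begin
      D₁ ⊓ D₂ + 1                           ≤⟨ +-monoˡ-≤ 1 (m⊓n≤n D₁ D₂) ⟩
      D₂ + 1                                ≡⟨ trans (+-comm D₂ 1) (sym (*-identityˡ (suc D₂))) ⟩
      1 * suc D₂                            ≡⟨ cong₂ _*_ (count-singleton v₁) (count-ClosedNbhd G₂ v₂) ⟨
      area R                                ≤⟨ area≤degreeIn X? R ⟩
      degreeIn (G₁ ⊠ G₂) X? (pair a v₂)     ∎
      where
      open ≤-Reasoning
      R : NbhdRectangle X a v₂
      R = record { side₁? = v₁ ≟_ ; side₂? = ClosedNbhd? G₂ v₂ ; ⊆members = inj₂
                 ; ⊆ClosedNbhd₁ = λ { refl → inj₂ (Nbhd-sym G₁ v₁∼a) } ; ⊆ClosedNbhd₂ = id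
                 ; avoids-centre = inj₁ λ { refl → Nbhd-irrefl G₁ v₁ v₁∼a } }

    beside₂ : ∀ {u} → u ∈ Nbhd G₂ v₂ → D₁ ⊓ D₂ + 1 ≤ degreeIn (G₁ ⊠ G₂) X? (pair v₁ u)
    beside₂ {u} v₂∼u = begin
      D₁ ⊓ D₂ + 1                           ≤⟨ +-monoˡ-≤ 1 (m⊓n≤m D₁ D₂) ⟩
      D₁ + 1                                ≡⟨ trans (+-comm D₁ 1) (sym (*-identityʳ (suc D₁))) ⟩
      suc D₁ * 1                            ≡⟨ cong₂ _*_ (count-ClosedNbhd G₁ v₁) (count-singleton v₂) ⟨
      area R                                ≤⟨ area≤degreeIn X? R ⟩
      degreeIn (G₁ ⊠ G₂) X? (pair v₁ u)     ∎
      where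
      open ≤-Reasoning
      R : NbhdRectangle X v₁ u
      R = record { side₁? = ClosedNbhd? G₁ v₁ ; side₂? = v₂ ≟_ ; ⊆members = inj₁
                 ; ⊆ClosedNbhd₁ = id ; ⊆ClosedNbhd₂ = λ { refl → inj₂ (Nbhd-sym G₂ v₂∼u) }
                 ; avoids-centre = inj₂ λ { refl → Nbhd-irrefl G₂ v₂ v₂∼u } }

    dense : ∀ {a u} → pair a u ∈ X → D₁ ⊓ D₂ + 1 ≤ degreeIn (G₁ ⊠ G₂) X? (pair a u)
    dense (inj₁ x∈X₁) with ⊗-pair⁻ {ClosedNbhd G₁ v₁} {｛ v₂ ｝} x∈X₁
    ... | inj₁ refl , refl = centre
    ... | inj₂ v₁∼a , refl = beside₁ v₁∼a
    dense (inj₂ x∈X₂) with ⊗-pair⁻ {｛ v₁ ｝} {ClosedNbhd G₂ v₂} x∈X₂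
    ... | refl , inj₁ refl = centre
    ... | refl , inj₂ v₂∼u = beside₂ v₂∼u

  core-maxDegree : {Δ₁ Δ₂ : ℕ} → IsMaxDegree G₁ Δ₁ → IsMaxDegree G₂ Δ₂ →
                   (a : Fin (n G₁)) → 0 < deg G₁ a → Fin (n G₂) → Core (G₁ ⊠ G₂) (Δ₁ ⊓ Δ₂ + 1)
  core-maxDegree maxDeg₁ maxDeg₂ a 0<deg-a u
    with v₁ , Δ₁≤deg ← maxDegreeVertex {G = G₁} maxDeg₁ a | v₂ , Δ₂≤deg ← maxDegreeVertex {G = G₂} maxDeg₂ u
    = core-weaken (+-monoˡ-≤ 1 (⊓-mono-≤ Δ₁≤deg Δ₂≤deg))
                  (core-cross v₁ v₂ (≤-trans 0<deg-a (≤-trans (proj₁ maxDeg₁ a) Δ₁≤deg)))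

  degeneracy-≤ : {d₁ d₂ Δ₁ Δ₂ d : ℕ} → EveryMinDegAtMost G₁ d₁ → EveryMinDegAtMost G₂ d₂ →
                 (∀ v → deg G₁ v ≤ Δ₁) → (∀ v → deg G₂ v ≤ Δ₂) →
                 IsDegeneracy (G₁ ⊠ G₂) d → d ≤ d₁ + d₂ + ((d₁ * Δ₂) ⊓ (d₂ * Δ₁))
  degeneracy-≤ {d₁} {d₂} {Δ₁} {Δ₂} {d} everyMinDeg₁ everyMinDeg₂ deg≤Δ₁ deg≤Δ₂ (_ , least) = begin
    d
      ≤⟨ ⊓-glb (least _ (everyMinDegAtMost-⊠ standard everyMinDeg₁ everyMinDeg₂ deg≤Δ₂))
               (least _ (everyMinDegAtMost-⊠ swapped everyMinDeg₂ everyMinDeg₁ deg≤Δ₁)) ⟩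
    (d₁ + d₂ + d₁ * Δ₂) ⊓ (d₂ + d₁ + d₂ * Δ₁)
      ≡⟨ cong (λ e → (d₁ + d₂ + d₁ * Δ₂) ⊓ (e + d₂ * Δ₁)) (+-comm d₂ d₁) ⟩
    (d₁ + d₂ + d₁ * Δ₂) ⊓ (d₁ + d₂ + d₂ * Δ₁)
      ≡⟨ +-distribˡ-⊓ (d₁ + d₂) (d₁ * Δ₂) (d₂ * Δ₁) ⟨
    d₁ + d₂ + ((d₁ * Δ₂) ⊓ (d₂ * Δ₁))
      ∎
    where open ≤-Reasoning

theorem15 : (G₁ G₂ : Graph) (Δ₁ Δ₂ d₁ d₂ s₁ t₁ s₂ t₂ : ℕ) →
    IsMaxDegree G₁ Δ₁ → IsMaxDegree G₂ Δ₂ →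
    IsDegeneracy G₁ d₁ → IsDegeneracy G₂ d₂ →
    1 ≤ s₁ → s₁ ≤ t₁ → 1 ≤ s₂ → s₂ ≤ t₂ →
    ContainsKst G₁ s₁ t₁ → ContainsKst G₂ s₂ t₂ →
    (d : ℕ) → IsDegeneracy (G₁ ⊠ G₂) d →
    ((d₁ + d₂ + d₁ * d₂) ⊔ f s₁ t₁ s₂ t₂ ⊔ ((Δ₁ ⊓ Δ₂) + 1) ≤ d)
    × (d ≤ d₁ + d₂ + ((d₁ * Δ₂) ⊓ (d₂ * Δ₁)))
theorem15 G₁ G₂ Δ₁ Δ₂ d₁ d₂ s₁ t₁ s₂ t₂ maxDeg₁ maxDeg₂ degen₁ degen₂
          0<s₁ s₁≤t₁ 0<s₂ s₂≤t₂ Kst₁ Kst₂ d degen =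
  ⊔-lub (⊔-lub (bound (core-⊗ (degeneracy⇒core degen₁ a₁) (degeneracy⇒core degen₂ a₂)))
               (⊔-lub (⊔-lub (bound (core-⊗ (biclique⇒core 0<s₁ s₁≤t₁ K₁) (biclique⇒core 0<s₂ s₂≤t₂ K₂)))
                             (bound (core-L⊗[L∪R]∪R⊗L K₁ K₂ 0<s₁ 0<s₂)))
                      (bound (core-L⊗R∪R⊗L K₁ K₂ 0<s₁ (≤-trans 0<s₂ s₂≤t₂)))))
        (bound (core-maxDegree maxDeg₁ maxDeg₂ a₁ 0<deg-a₁ a₂))
  , degeneracy-≤ (proj₁ degen₁) (proj₁ degen₂) (proj₁ maxDeg₁) (proj₁ maxDeg₂) degen
  where
  open StrongProduct G₁ G₂
  K₁ = biclique Kst₁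
  K₂ = biclique Kst₂
  a₁ = proj₁ (Biclique.left-nonempty K₁ 0<s₁)
  a₂ = proj₁ (Biclique.left-nonempty K₂ 0<s₂)
  0<deg-a₁ = ≤-trans 0<s₁ (≤-trans s₁≤t₁ (Biclique.t≤deg-left K₁ (proj₂ (Biclique.left-nonempty K₁ 0<s₁))))

  bound : Core (G₁ ⊠ G₂) k → k ≤ d
  bound core = core⇒≤ core (proj₁ degen)
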